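{- Let $G(u)=\sum_P x^{\mathrm{col}(P)}u^{\mathrm{first}(P)}$, summed over all Stanley polyominoes $P$, and let $r=\frac{1-\sqrt{1-4x}}{2x}$, $s=\frac{1+\sqrt{1-4x}}{2x}$. Then \[ G(u)=\frac{u}{r(s-u)}=\frac{\left(2-u-\sqrt{1-4x}\,u\right)xu}{2u^{2}x-2u+2}. \] Moreover, for $n\geq 2$ and $1\leq k\leq n$, \[ [u^k]G(u)=x(rx)^{k-1}\quad\text{and}\quad [x^nu^k]G(u)=\frac{k-1}{2n-k-1}\binom{2n-k-1}{n-k}. \]
   Context: Cells are unit squares $[i,i+1]\times[j,j+1]$ with $i,j\in\mathbb{Z}$. A Stanley polyomino (up to translation) is a set of cells forming $k\geq 1$ rows $0,\dots,k-1$ (bottom to top), row $j$ consisting of the cells with $s_j\le i\le e_j$ ($s_j\le e_j$ integers), such that $s_{j-1}<s_j\le e_{j-1}<e_j$ for $1\le j\le k-1$. Here $\mathrm{col}(P)=e_{k-1}-s_0+1$ is the number of columns and $\mathrm{first}(P)=e_0-s_0+1$ is the number of cells in the first (bottom) row. -}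

module Defs where

open import Data.Nat using (ℕ; zero; suc; _∸_; _≤ᵇ_; _<ᵇ_; _≡ᵇ_)
open import Data.Bool using (Bool; true; false; _∧_; T)
open import Data.Product using (Σ; _×_; _,_)
open import Data.List using (List; []; _∷_)
open import Data.Integer using (ℤ; +_) renaming (_+_ to _+ℤ_; _*_ to _*ℤ_; -_ to -ℤ_)
open import Relation.Binary.PropositionalEquality using (_≡_)

-- Stanley polyominoes (normalised up to translation by s₀ = 0).
-- A polyomino is the list of its rows, bottom row first; row j is the
-- pair (s_j , e_j).  Since s₀ = 0 and the s_j increase, all coordinates
-- are natural numbers.

Row : Set
Row = ℕ × ℕ

chain : Row → List Row → Bool
chain _ [] = true
chain (s , e) ((s' , e') ∷ rs) =
  (s <ᵇ s') ∧ (s' ≤ᵇ e) ∧ (e <ᵇ e') ∧ (s' ≤ᵇ e') ∧ chain (s' , e') rs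

isStanley : List Row → Bool
isStanley [] = false
isStanley ((s , e) ∷ rs) = (s ≡ᵇ 0) ∧ (s ≤ᵇ e) ∧ chain (s , e) rs

lastE : Row → List Row → ℕ
lastE (_ , e) [] = e
lastE _ (r ∷ rs) = lastE r rs

col : List Row → ℕ
col [] = 0
col ((s , e) ∷ rs) = suc (lastE (s , e) rs) ∸ s

first : List Row → ℕ
first [] = 0
first ((s , e) ∷ rs) = suc e ∸ s

StanleyWith : ℕ → ℕ → Set
StanleyWith n k = Σ (List Row) λ p → T (isStanley p) × col p ≡ n × first p ≡ k

-- Formal power series in two variables x, u with integer coefficients:
-- F n k is the coefficient of x^n u^k.

Ser : Set
Ser = ℕ → ℕ → ℤ

sumTo : ℕ → (ℕ → ℤ) → ℤ
sumTo zero f = f 0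
sumTo (suc n) f = sumTo n f +ℤ f (suc n)

_⊕_ : Ser → Ser → Ser
(f ⊕ g) n k = f n k +ℤ g n k

_⊖_ : Ser → Ser → Ser
(f ⊖ g) n k = f n k +ℤ (-ℤ g n k)

_⊗_ : Ser → Ser → Ser
(f ⊗ g) n k = sumTo n λ i → sumTo k λ j → f i j *ℤ g (n ∸ i) (k ∸ j)

infixl 6 _⊕_ _⊖_
infixl 7 _⊗_

cst : ℤ → Ser
cst c zero zero = c
cst c _ _ = + 0

X : Ser
X 1 0 = + 1
X _ _ = + 0

U : Ser
U 0 1 = + 1
U _ _ = + 0

_^ˢ_ : Ser → ℕ → Ser
f ^ˢ zero = cst (+ 1)
f ^ˢ suc m = f ⊗ (f ^ˢ m)

_≐_ : Ser → Ser → Set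
f ≐ g = ∀ n k → f n k ≡ g n k

infix 4 _≐_

OnlyX : Ser → Set
OnlyX f = ∀ n k → f n (suc k) ≡ + 0

{-# OPTIONS --safe #-}
module Submission where

-- Removing the bottom row (0 , e) identifies the Stanley polyominoes with
-- first = e + 1 and col = m + 1 with the chains of rows above (0 , e) whose
-- last row ends in column m.  Their numbers c m e obey the ballot recurrence
-- c (m+1) (e+1) = c m e + c (m+1) (e+2), with c 0 0 = 1, c (m+1) 0 = 0 and
-- c m e = 0 for m < e, and these data determine c.  On the algebraic side
-- the hypotheses give r T = 1 and T = 1 - P for P = r x, hence the Catalan
-- equation P = x + P²; so the coefficients [x^m] P^e obey the same
-- recurrence, and [u^(k+1)] G = x P^k.  This is G = (x + P G) u, i.e.
-- G (1 - P u) = x u, from which both closed forms follow because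
-- 2 u² x - 2 u + 2 = (1 - P u) (2 - 2 T u).  Solving the recurrence
-- explicitly gives the coefficient formula.

open import Algebra.Bundles using (CommutativeRing; RawRing)
open import Algebra.Morphism.Structures using (IsRingMonomorphism)
import Algebra.Morphism.RingMonomorphism as RingMonomorphism
open import Algebra.Solver.Ring.AlmostCommutativeRing using (_-Raw-AlmostCommutative⟶_; fromCommutativeRing)
open import Algebra.Structures using (IsCommutativeRing)
open import Data.Bool using (T; _∧_)
open import Data.Bool.Properties using (T-∧; T-irrelevant)
open import Data.Empty using (⊥-elim)
open import Data.Fin as Fin using (Fin)
import Data.Fin.Properties as Fin
open import Data.Fin.Permutation using (↔⇒≡)
open import Data.Integer as ℤ using (ℤ; +_)
import Data.Integer.Properties as ℤ
open import Data.List as List using (List; _∷_; [])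
open import Data.Maybe using (Maybe; just; nothing)
open import Data.Nat as ℕ using (ℕ; zero; suc; _∸_; _≤_; _<_; z≤n; s≤s; z<s)
import Algebra.Construct.Pointwise ℕ as Pointwise
open import Data.Nat.Combinatorics using (_C_; nC1≡n; k>n⇒nCk≡0; nCk+nC[k+1]≡[n+1]C[k+1])
import Data.Nat.Properties as ℕ
open import Data.Nat.Tactic.RingSolver using (solve-∀) renaming (solve to solveℕ)
open import Data.Product as Product using (Σ; _,_; _×_; proj₁)
open import Data.Sum using (_⊎_; inj₁; inj₂)
open import Data.Sum.Function.Propositional using (_⊎-↔_)
open import Function using (_∘_; id)
open import Function.Bundles using (_↔_; Inverse; Equivalence; mk↔ₛ′)
open import Function.Properties.Inverse using (↔-trans; ↔-sym)
open import Level using (0ℓ)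
open import Relation.Binary.PropositionalEquality as ≡ using (_≡_)
import Relation.Binary.Reasoning.Setoid
open import Relation.Nullary using (¬_; yes; no)

open import Defs

-- Formal power series over a commutative ring

module FormalPowerSeries {c ℓ} (R : CommutativeRing c ℓ) where

  open CommutativeRing R hiding (isCommutativeRing)
  open import Algebra.Properties.CommutativeSemigroup +-commutativeSemigroup using (interchange)
  open Relation.Binary.Reasoning.Setoid setoid

  ∑ : ℕ → (ℕ → Carrier) → Carrier
  ∑ zero    f = f 0
  ∑ (suc n) f = ∑ n f + f (suc n)

  ∑-cong : ∀ n {f g : ℕ → Carrier} → (∀ {i} → i ≤ n → f i ≈ g i) → ∑ n f ≈ ∑ n g
  ∑-cong zero    f≈g = f≈g z≤n
  ∑-cong (suc n) f≈g = +-cong (∑-cong n (f≈g ∘ ℕ.m≤n⇒m≤1+n)) (f≈g ℕ.≤-refl)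

  ∑-+ : ∀ n (f g : ℕ → Carrier) → ∑ n (λ i → f i + g i) ≈ ∑ n f + ∑ n g
  ∑-+ zero    f g = refl
  ∑-+ (suc n) f g = trans (+-congʳ (∑-+ n f g)) (interchange _ _ _ _)

  ∑-*ˡ : ∀ n a (f : ℕ → Carrier) → ∑ n (λ i → a * f i) ≈ a * ∑ n f
  ∑-*ˡ zero    a f = refl
  ∑-*ˡ (suc n) a f = trans (+-congʳ (∑-*ˡ n a f)) (sym (distribˡ a _ _))

  ∑-zero : ∀ n {f : ℕ → Carrier} → (∀ i → f i ≈ 0#) → ∑ n f ≈ 0#
  ∑-zero zero    f≈0 = f≈0 0
  ∑-zero (suc n) f≈0 = trans (+-cong (∑-zero n f≈0) (f≈0 (suc n))) (+-identityˡ 0#)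

  ∑-head : ∀ n (f : ℕ → Carrier) → ∑ (suc n) f ≈ f 0 + ∑ n (f ∘ suc)
  ∑-head zero    f = refl
  ∑-head (suc n) f = trans (+-congʳ (∑-head n f)) (+-assoc _ _ _)

  ∑-reverse : ∀ n (f : ℕ → Carrier) → ∑ n f ≈ ∑ n (λ i → f (n ∸ i))
  ∑-reverse zero    f = refl
  ∑-reverse (suc n) f = begin
    ∑ n f + f (suc n)                        ≈⟨ +-congʳ (∑-reverse n f) ⟩
    ∑ n (λ i → f (n ∸ i)) + f (suc n)        ≈⟨ +-comm _ _ ⟩
    f (suc n) + ∑ n (λ i → f (suc n ∸ suc i)) ≈⟨ ∑-head n (λ i → f (suc n ∸ i)) ⟨
    ∑ (suc n) (λ i → f (suc n ∸ i))          ∎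

  Series : Set c
  Series = ℕ → Carrier

  infix  4 _≋_
  infixl 6 _⊞_
  infixl 7 _⊠_
  infix  8 ⊟_

  _≋_ : Series → Series → Set ℓ
  f ≋ g = ∀ n → f n ≈ g n

  _⊞_ : Series → Series → Series
  (f ⊞ g) n = f n + g n

  ⊟_ : Series → Series
  (⊟ f) n = - f n

  _⊠_ : Series → Series → Series
  (f ⊠ g) n = ∑ n (λ i → f i * g (n ∸ i))

  const : Carrier → Series
  const a zero    = a
  const a (suc n) = 0#

  x : Series
  x zero    = 0#
  x (suc n) = const 1# n

  ⊠-cong : ∀ {f f′ g g′} → f ≋ f′ → g ≋ g′ → f ⊠ g ≋ f′ ⊠ g′
  ⊠-cong f≋f′ g≋g′ n = ∑-cong n (λ {i} _ → *-cong (f≋f′ i) (g≋g′ (n ∸ i)))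

  ⊠-comm : ∀ f g → f ⊠ g ≋ g ⊠ f
  ⊠-comm f g n = trans (∑-reverse n _) (∑-cong n λ {i} i≤n →
    trans (*-comm _ _) (*-congʳ (reflexive (≡.cong g (ℕ.m∸[m∸n]≡n i≤n)))))

  ⊠-head : ∀ f g n → (f ⊠ g) (suc n) ≈ f 0 * g (suc n) + ((f ∘ suc) ⊠ g) n
  ⊠-head f g n = ∑-head n _

  const-⊠ : ∀ a f n → (const a ⊠ f) n ≈ a * f n
  const-⊠ a f zero    = refl
  const-⊠ a f (suc n) = begin
    (const a ⊠ f) (suc n)                           ≈⟨ ⊠-head (const a) f n ⟩
    a * f (suc n) + ∑ n (λ i → 0# * f (n ∸ i))      ≈⟨ +-congˡ (∑-zero n (λ i → zeroˡ _)) ⟩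
    a * f (suc n) + 0#                              ≈⟨ +-identityʳ _ ⟩
    a * f (suc n)                                   ∎

  x-⊠-zero : ∀ f → (x ⊠ f) 0 ≈ 0#
  x-⊠-zero f = zeroˡ (f 0)

  x-⊠-suc : ∀ f n → (x ⊠ f) (suc n) ≈ f n
  x-⊠-suc f n = begin
    (x ⊠ f) (suc n)                    ≈⟨ ⊠-head x f n ⟩
    0# * f (suc n) + (const 1# ⊠ f) n  ≈⟨ +-cong (zeroˡ _) (const-⊠ 1# f n) ⟩
    0# + 1# * f n                      ≈⟨ +-identityˡ _ ⟩
    1# * f n                           ≈⟨ *-identityˡ _ ⟩
    f n                                ∎

  ⊠-distribʳ : ∀ h f g → (f ⊞ g) ⊠ h ≋ f ⊠ h ⊞ g ⊠ h
  ⊠-distribʳ h f g n = trans (∑-cong n (λ _ → distribʳ _ _ _)) (∑-+ n _ _)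

  ⊠-scalarˡ : ∀ a f g → (λ n → a * f n) ⊠ g ≋ (λ n → a * (f ⊠ g) n)
  ⊠-scalarˡ a f g n = trans (∑-cong n (λ _ → *-assoc _ _ _)) (∑-*ˡ n a _)

  ⊠-assoc : ∀ f g h → (f ⊠ g) ⊠ h ≋ f ⊠ (g ⊠ h)
  ⊠-assoc f g h zero    = *-assoc _ _ _
  ⊠-assoc f g h (suc n) = begin
    ((f ⊠ g) ⊠ h) (suc n)
      ≈⟨ ⊠-head (f ⊠ g) h n ⟩
    (f 0 * g 0) * h (suc n) + (((f ⊠ g) ∘ suc) ⊠ h) n
      ≈⟨ +-congˡ (⊠-cong {g = h} (⊠-head f g) (λ _ → refl) n) ⟩
    (f 0 * g 0) * h (suc n) + ((f0·g′ ⊞ (f ∘ suc) ⊠ g) ⊠ h) n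
      ≈⟨ +-congˡ (⊠-distribʳ h f0·g′ ((f ∘ suc) ⊠ g) n) ⟩
    (f 0 * g 0) * h (suc n) + ((f0·g′ ⊠ h) n + (((f ∘ suc) ⊠ g) ⊠ h) n)
      ≈⟨ +-congˡ (+-cong (⊠-scalarˡ (f 0) (g ∘ suc) h n) (⊠-assoc (f ∘ suc) g h n)) ⟩
    (f 0 * g 0) * h (suc n) + (f 0 * ((g ∘ suc) ⊠ h) n + ((f ∘ suc) ⊠ (g ⊠ h)) n)
      ≈⟨ +-assoc _ _ _ ⟨
    ((f 0 * g 0) * h (suc n) + f 0 * ((g ∘ suc) ⊠ h) n) + ((f ∘ suc) ⊠ (g ⊠ h)) n
      ≈⟨ +-congʳ (trans (+-congʳ (*-assoc _ _ _)) (sym (distribˡ _ _ _))) ⟩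
    f 0 * (g 0 * h (suc n) + ((g ∘ suc) ⊠ h) n) + ((f ∘ suc) ⊠ (g ⊠ h)) n
      ≈⟨ +-congʳ (*-congˡ (⊠-head g h n)) ⟨
    f 0 * (g ⊠ h) (suc n) + ((f ∘ suc) ⊠ (g ⊠ h)) n
      ≈⟨ ⊠-head f (g ⊠ h) n ⟨
    (f ⊠ (g ⊠ h)) (suc n)
      ∎
    where
    f0·g′ : Series
    f0·g′ m = f 0 * g (suc m)

  ⊠-identityˡ : ∀ f → const 1# ⊠ f ≋ f
  ⊠-identityˡ f n = trans (const-⊠ 1# f n) (*-identityˡ (f n))

  ⊠-distribˡ : ∀ h f g → h ⊠ (f ⊞ g) ≋ h ⊠ f ⊞ h ⊠ g
  ⊠-distribˡ h f g n = begin
    (h ⊠ (f ⊞ g)) n          ≈⟨ ⊠-comm h (f ⊞ g) n ⟩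
    ((f ⊞ g) ⊠ h) n          ≈⟨ ⊠-distribʳ h f g n ⟩
    (f ⊠ h) n + (g ⊠ h) n    ≈⟨ +-cong (⊠-comm f h n) (⊠-comm g h n) ⟩
    (h ⊠ f) n + (h ⊠ g) n    ∎

  isCommutativeRing : IsCommutativeRing _≋_ _⊞_ _⊠_ ⊟_ (λ _ → 0#) (const 1#)
  isCommutativeRing = record
    { isRing = record
      { +-isAbelianGroup = Pointwise.isAbelianGroup +-isAbelianGroup
      ; *-cong           = ⊠-cong
      ; *-assoc          = ⊠-assoc
      ; *-identity       = ⊠-identityˡ , λ f n → trans (⊠-comm f (const 1#) n) (⊠-identityˡ f n)
      ; distrib          = ⊠-distribˡ , ⊠-distribʳ
      }
    ; *-comm = ⊠-comm
    }

  commutativeRing : CommutativeRing c ℓ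
  commutativeRing = record { isCommutativeRing = isCommutativeRing }

-- Bivariate series

-- Ser is definitionally ℤ[[u]][[x]].Series, the x-degree being the outer
-- index; sums, scalars and the ring structure are transported from there.

module ℤ[[u]] = FormalPowerSeries ℤ.+-*-commutativeRing
module ℤ[[u]][[x]] = FormalPowerSeries ℤ[[u]].commutativeRing

⊝_ : Ser → Ser
(⊝ f) n k = ℤ.- f n k

≐-refl : ∀ {f} → f ≐ f
≐-refl n k = ≡.refl

sumTo≡∑ : ∀ n f → sumTo n f ≡ ℤ[[u]].∑ n f
sumTo≡∑ zero    f = ≡.refl
sumTo≡∑ (suc n) f = ≡.cong (ℤ._+ f (suc n)) (sumTo≡∑ n f)

sumTo-cong : ∀ n {f h : ℕ → ℤ} → (∀ i → f i ≡ h i) → sumTo n f ≡ sumTo n h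
sumTo-cong n {f} {h} f≡h =
  ≡.trans (sumTo≡∑ n f) (≡.trans (ℤ[[u]].∑-cong n (λ {i} _ → f≡h i)) (≡.sym (sumTo≡∑ n h)))

sumTo-zero : ∀ n {f : ℕ → ℤ} → (∀ i → f i ≡ + 0) → sumTo n f ≡ + 0
sumTo-zero n {f} f≡0 = ≡.trans (sumTo≡∑ n f) (ℤ[[u]].∑-zero n f≡0)

∑-coefficient : ∀ n (φ : ℕ → ℕ → ℤ) k → ℤ[[u]][[x]].∑ n φ k ≡ ℤ[[u]].∑ n (λ i → φ i k)
∑-coefficient zero    φ k = ≡.refl
∑-coefficient (suc n) φ k = ≡.cong (ℤ._+ φ (suc n) k) (∑-coefficient n φ k)

⊗≐⊠ : ∀ f g → f ⊗ g ≐ f ℤ[[u]][[x]].⊠ g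
⊗≐⊠ f g n k = begin
  sumTo n (λ i → sumTo k (λ j → f i j ℤ.* g (n ∸ i) (k ∸ j)))
    ≡⟨ sumTo≡∑ n _ ⟩
  ℤ[[u]].∑ n (λ i → sumTo k (λ j → f i j ℤ.* g (n ∸ i) (k ∸ j)))
    ≡⟨ ℤ[[u]].∑-cong n (λ {i} _ → sumTo≡∑ k _) ⟩
  ℤ[[u]].∑ n (λ i → (f i ℤ[[u]].⊠ g (n ∸ i)) k)
    ≡⟨ ∑-coefficient n (λ i → f i ℤ[[u]].⊠ g (n ∸ i)) k ⟨
  (f ℤ[[u]][[x]].⊠ g) n k
    ∎
  where open ≡.≡-Reasoning

cst≐const : ∀ a → cst a ≐ ℤ[[u]][[x]].const (ℤ[[u]].const a)
cst≐const a zero    zero    = ≡.refl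
cst≐const a zero    (suc k) = ≡.refl
cst≐const a (suc n) k       = ≡.refl

cst-0 : cst (+ 0) ≐ (λ _ _ → + 0)
cst-0 zero    zero    = ≡.refl
cst-0 zero    (suc k) = ≡.refl
cst-0 (suc n) k       = ≡.refl

X≐x : X ≐ ℤ[[u]][[x]].x
X≐x zero          k       = ≡.refl
X≐x (suc zero)    zero    = ≡.refl
X≐x (suc zero)    (suc k) = ≡.refl
X≐x (suc (suc n)) k       = ≡.refl

U≐const-x : U ≐ ℤ[[u]][[x]].const ℤ[[u]].x
U≐const-x zero    zero          = ≡.refl
U≐const-x zero    (suc zero)    = ≡.refl
U≐const-x zero    (suc (suc k)) = ≡.refl
U≐const-x (suc n) k             = ≡.refl

Ser-rawRing : RawRing 0ℓ 0ℓ
Ser-rawRing = record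
  { Carrier = Ser ; _≈_ = _≐_ ; _+_ = _⊕_ ; _*_ = _⊗_ ; -_ = ⊝_
  ; 0# = cst (+ 0) ; 1# = cst (+ 1) }

id-isRingMonomorphism :
  IsRingMonomorphism Ser-rawRing (CommutativeRing.rawRing ℤ[[u]][[x]].commutativeRing) id
id-isRingMonomorphism = record
  { isRingHomomorphism = record
    { isSemiringHomomorphism = record
      { isNearSemiringHomomorphism = record
        { +-isMonoidHomomorphism = record
          { isMagmaHomomorphism = record
            { isRelHomomorphism = record { cong = id }
            ; homo = λ _ _ → ≐-refl }
          ; ε-homo = cst-0 }
        ; *-homo = ⊗≐⊠ }
      ; 1#-homo = cst≐const (+ 1) }
    ; -‿homo = λ _ → ≐-refl }
  ; injective = id }

Ser-commutativeRing : CommutativeRing 0ℓ 0ℓ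
Ser-commutativeRing = record
  { isCommutativeRing = RingMonomorphism.isCommutativeRing id-isRingMonomorphism
                          ℤ[[u]][[x]].isCommutativeRing }

open CommutativeRing Ser-commutativeRing
  using () renaming (+-cong to ⊕-cong; *-cong to ⊗-cong; -‿cong to ⊝-cong; *-assoc to ⊗-assoc)

module ≐-Reasoning = Relation.Binary.Reasoning.Setoid (CommutativeRing.setoid Ser-commutativeRing)

⊖-cong : ∀ {F F′ H H′} → F ≐ F′ → H ≐ H′ → F ⊖ H ≐ F′ ⊖ H′
⊖-cong F≐F′ H≐H′ = ⊕-cong F≐F′ (⊝-cong H≐H′)

cst-⊗ : ∀ a f → cst a ⊗ f ≐ (λ n k → a ℤ.* f n k)
cst-⊗ a f n k = begin
  (cst a ⊗ f) n k
    ≡⟨ ⊗≐⊠ (cst a) f n k ⟩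
  (cst a ℤ[[u]][[x]].⊠ f) n k
    ≡⟨ ℤ[[u]][[x]].⊠-cong (cst≐const a) (≐-refl {f}) n k ⟩
  (ℤ[[u]][[x]].const (ℤ[[u]].const a) ℤ[[u]][[x]].⊠ f) n k
    ≡⟨ ℤ[[u]][[x]].const-⊠ (ℤ[[u]].const a) f n k ⟩
  (ℤ[[u]].const a ℤ[[u]].⊠ f n) k
    ≡⟨ ℤ[[u]].const-⊠ a (f n) k ⟩
  a ℤ.* f n k
    ∎
  where open ≡.≡-Reasoning

cst-+ : ∀ a b → cst (a ℤ.+ b) ≐ cst a ⊕ cst b
cst-+ a b zero    zero    = ≡.refl
cst-+ a b zero    (suc k) = ≡.refl
cst-+ a b (suc n) k       = ≡.refl

cst-* : ∀ a b → cst (a ℤ.* b) ≐ cst a ⊗ cst b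
cst-* a b n k = ≡.trans (scaled n k) (≡.sym (cst-⊗ a (cst b) n k))
  where
  scaled : ∀ n k → cst (a ℤ.* b) n k ≡ a ℤ.* cst b n k
  scaled zero    zero    = ≡.refl
  scaled zero    (suc k) = ≡.sym (ℤ.*-zeroʳ a)
  scaled (suc n) k       = ≡.sym (ℤ.*-zeroʳ a)

cst-neg : ∀ a → cst (ℤ.- a) ≐ ⊝ cst a
cst-neg a zero    zero    = ≡.refl
cst-neg a zero    (suc k) = ≡.refl
cst-neg a (suc n) k       = ≡.refl

cst-morphism : ℤ.+-*-rawRing -Raw-AlmostCommutative⟶ fromCommutativeRing Ser-commutativeRing
cst-morphism = record
  { ⟦_⟧    = cst
  ; +-homo = cst-+
  ; *-homo = cst-*
  ; -‿homo = cst-neg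
  ; 0-homo = ≐-refl
  ; 1-homo = ≐-refl
  }

cst-≟ : ∀ a b → Maybe (cst a ≐ cst b)
cst-≟ a b with a ℤ.≟ b
... | yes ≡.refl = just ≐-refl
... | no _       = nothing

open import Algebra.Solver.Ring ℤ.+-*-rawRing (fromCommutativeRing Ser-commutativeRing) cst-morphism cst-≟
  using (solve; _:=_; _:+_; _:*_; _:-_; con)

X-⊗-zero : ∀ F k → (X ⊗ F) 0 k ≡ + 0
X-⊗-zero F k = ≡.trans (⊗≐⊠ X F 0 k)
  (≡.trans (ℤ[[u]][[x]].⊠-cong X≐x (≐-refl {F}) 0 k) (ℤ[[u]][[x]].x-⊠-zero F k))

X-⊗-suc : ∀ F n k → (X ⊗ F) (suc n) k ≡ F n k
X-⊗-suc F n k = begin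
  (X ⊗ F) (suc n) k                     ≡⟨ ⊗≐⊠ X F (suc n) k ⟩
  (X ℤ[[u]][[x]].⊠ F) (suc n) k         ≡⟨ ℤ[[u]][[x]].⊠-cong X≐x (≐-refl {F}) (suc n) k ⟩
  (ℤ[[u]][[x]].x ℤ[[u]][[x]].⊠ F) (suc n) k ≡⟨ ℤ[[u]][[x]].x-⊠-suc F n k ⟩
  F n k                                 ∎
  where open ≡.≡-Reasoning

⊗-U≋x-⊠ : ∀ F n → (F ⊗ U) n ℤ[[u]].≋ ℤ[[u]].x ℤ[[u]].⊠ F n
⊗-U≋x-⊠ F n k = begin
  (F ⊗ U) n k
    ≡⟨ ⊗≐⊠ F U n k ⟩
  (F ℤ[[u]][[x]].⊠ U) n k
    ≡⟨ ℤ[[u]][[x]].⊠-comm F U n k ⟩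
  (U ℤ[[u]][[x]].⊠ F) n k
    ≡⟨ ℤ[[u]][[x]].⊠-cong U≐const-x (≐-refl {F}) n k ⟩
  (ℤ[[u]][[x]].const ℤ[[u]].x ℤ[[u]][[x]].⊠ F) n k
    ≡⟨ ℤ[[u]][[x]].const-⊠ ℤ[[u]].x F n k ⟩
  (ℤ[[u]].x ℤ[[u]].⊠ F n) k
    ∎
  where open ≡.≡-Reasoning

⊗-U-zero : ∀ F n → (F ⊗ U) n 0 ≡ + 0
⊗-U-zero F n = ≡.trans (⊗-U≋x-⊠ F n 0) (ℤ[[u]].x-⊠-zero (F n))

⊗-U-suc : ∀ F n k → (F ⊗ U) n (suc k) ≡ F n k
⊗-U-suc F n k = ≡.trans (⊗-U≋x-⊠ F n (suc k)) (ℤ[[u]].x-⊠-suc (F n) k)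

onlyX-⊗ : ∀ {A} → OnlyX A → ∀ F n k → (A ⊗ F) n k ≡ sumTo n (λ i → A i 0 ℤ.* F (n ∸ i) k)
onlyX-⊗ {A} onlyX-A F n k = begin
  (A ⊗ F) n k                                          ≡⟨ ⊗≐⊠ A F n k ⟩
  (A ℤ[[u]][[x]].⊠ F) n k                              ≡⟨ ∑-coefficient n _ k ⟩
  ℤ[[u]].∑ n (λ i → (A i ℤ[[u]].⊠ F (n ∸ i)) k)        ≡⟨ ℤ[[u]].∑-cong n (λ {i} _ → coefficient i) ⟩
  ℤ[[u]].∑ n (λ i → A i 0 ℤ.* F (n ∸ i) k)             ≡⟨ sumTo≡∑ n _ ⟨
  sumTo n (λ i → A i 0 ℤ.* F (n ∸ i) k)                ∎
  where
  open ≡.≡-Reasoning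
  Aᵢ≋const : ∀ i → A i ℤ[[u]].≋ ℤ[[u]].const (A i 0)
  Aᵢ≋const i zero    = ≡.refl
  Aᵢ≋const i (suc k) = onlyX-A i k
  coefficient : ∀ i → (A i ℤ[[u]].⊠ F (n ∸ i)) k ≡ A i 0 ℤ.* F (n ∸ i) k
  coefficient i = ≡.trans (ℤ[[u]].⊠-cong {g = F (n ∸ i)} (Aᵢ≋const i) (λ _ → ≡.refl) k)
                          (ℤ[[u]].const-⊠ (A i 0) (F (n ∸ i)) k)

onlyX-X : OnlyX X
onlyX-X zero          k = ≡.refl
onlyX-X (suc zero)    k = ≡.refl
onlyX-X (suc (suc n)) k = ≡.refl

onlyX-⊗-closed : ∀ {A B} → OnlyX A → OnlyX B → OnlyX (A ⊗ B)
onlyX-⊗-closed {A} {B} onlyX-A onlyX-B n k =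
  ≡.trans (onlyX-⊗ {A} onlyX-A B n (suc k)) (sumTo-zero n vanishes)
  where
  vanishes : ∀ i → A i 0 ℤ.* B (n ∸ i) (suc k) ≡ + 0
  vanishes i = ≡.trans (≡.cong (A i 0 ℤ.*_) (onlyX-B (n ∸ i) k)) (ℤ.*-zeroʳ (A i 0))

X-⊗-cancel : ∀ {F H} → X ⊗ F ≐ X ⊗ H → F ≐ H
X-⊗-cancel {F} {H} XF≐XH n k =
  ≡.trans (≡.sym (X-⊗-suc F n k)) (≡.trans (XF≐XH (suc n) k) (X-⊗-suc H n k))

cst-⊗-cancel : ∀ c .{{_ : ℤ.NonZero c}} {F H} → cst c ⊗ F ≐ cst c ⊗ H → F ≐ H
cst-⊗-cancel c {F} {H} cF≐cH n k =
  ℤ.*-cancelˡ-≡ c (F n k) (H n k) (≡.trans (≡.sym (cst-⊗ c F n k)) (≡.trans (cF≐cH n k) (cst-⊗ c H n k)))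

-- Ballot numbers

open import Data.Nat using (_+_; _*_)

ballot : ℕ → ℕ → ℕ
ballot zero    e       = 1
ballot (suc d) zero    = 0
ballot (suc d) (suc e) = ballot (suc d) e + ballot d (suc (suc e))

-- f m e stands for the number of Stanley polyominoes with col = m + 1 and
-- first = e + 1.
record IsBallotTable (f : ℕ → ℕ → ℤ) : Set where
  field
    corner         : f 0 0 ≡ + 1
    left-column    : ∀ m → f (suc m) 0 ≡ + 0
    below-diagonal : ∀ {m e} → m < e → f m e ≡ + 0
    recurrence     : ∀ m e → f (suc m) (suc e) ≡ f m e ℤ.+ f (suc m) (suc (suc e))

  diagonal : ∀ e → f e e ≡ + 1
  diagonal zero    = corner
  diagonal (suc e) = begin
    f (suc e) (suc e)                         ≡⟨ recurrence e e ⟩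
    f e e ℤ.+ f (suc e) (suc (suc e))         ≡⟨ ≡.cong₂ ℤ._+_ (diagonal e) (below-diagonal (ℕ.n<1+n (suc e))) ⟩
    + 1                                       ∎
    where open ≡.≡-Reasoning

  ballot-entry : ∀ d e → f (d + e) e ≡ + ballot d e
  ballot-entry zero    e       = diagonal e
  ballot-entry (suc d) zero    = left-column (d + 0)
  ballot-entry (suc d) (suc e) = begin
    f (suc (d + suc e)) (suc e)
      ≡⟨ recurrence (d + suc e) e ⟩
    f (d + suc e) e ℤ.+ f (suc (d + suc e)) (suc (suc e))
      ≡⟨ ≡.cong₂ (λ m m′ → f m e ℤ.+ f m′ (suc (suc e))) (ℕ.+-suc d e) (≡.sym (ℕ.+-suc d (suc e))) ⟩
    f (suc d + e) e ℤ.+ f (d + suc (suc e)) (suc (suc e))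
      ≡⟨ ≡.cong₂ ℤ._+_ (ballot-entry (suc d) e) (ballot-entry d (suc (suc e))) ⟩
    + ballot (suc d) e ℤ.+ + ballot d (suc (suc e))
      ∎
    where open ≡.≡-Reasoning

open IsBallotTable using (below-diagonal; ballot-entry)

ballot-tables-agree : ∀ {f h} → IsBallotTable f → IsBallotTable h → ∀ m e → f m e ≡ h m e
ballot-tables-agree {f} {h} F H m e with e ℕ.≤? m
... | no e≰m  = ≡.trans (below-diagonal F (ℕ.≰⇒> e≰m)) (≡.sym (below-diagonal H (ℕ.≰⇒> e≰m)))
... | yes e≤m = ≡.subst (λ m → f m e ≡ h m e) (ℕ.m∸n+n≡m e≤m)
                  (≡.trans (ballot-entry F (m ∸ e) e) (≡.sym (ballot-entry H (m ∸ e) e)))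

absorption : ∀ n k → suc k * (suc n C suc k) ≡ suc n * (n C k)
absorption n       zero    =
  ≡.trans (ℕ.*-identityˡ _) (≡.trans (nC1≡n (suc n)) (≡.sym (ℕ.*-identityʳ (suc n))))
absorption zero    (suc k) =
  ≡.trans (≡.cong (suc (suc k) *_) (k>n⇒nCk≡0 {1} {suc (suc k)} (s≤s (s≤s z≤n)))) (ℕ.*-zeroʳ (suc (suc k)))
absorption (suc n) (suc k) = begin
  suc (suc k) * (suc (suc n) C suc (suc k))          ≡⟨ ≡.cong (suc (suc k) *_) (pascal (suc n) (suc k)) ⟨
  suc (suc k) * (a + b)                             ≡⟨ expand k a b ⟩
  a + suc k * a + suc (suc k) * b               ≡⟨ ≡.cong₂ (λ p q → a + p + q) (absorption n k) (absorption n (suc k)) ⟩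
  a + suc n * (n C k) + suc n * (n C suc k)     ≡⟨ ℕ.+-assoc a _ _ ⟩
  a + (suc n * (n C k) + suc n * (n C suc k))   ≡⟨ ≡.cong (λ z → a + z) (ℕ.*-distribˡ-+ (suc n) (n C k) (n C suc k)) ⟨
  a + suc n * (n C k + n C suc k)                 ≡⟨ ≡.cong (λ p → a + suc n * p) (pascal n k) ⟩
  a + suc n * a                                     ∎
  where
  open ≡.≡-Reasoning
  pascal = nCk+nC[k+1]≡[n+1]C[k+1]
  a = suc n C suc k
  b = suc n C suc (suc k)
  expand : ∀ k a b → suc (suc k) * (a + b) ≡ a + suc k * a + suc (suc k) * b
  expand = solve-∀

-- The inductive step of ballot-closed-form, with the width N = 2 (d + 1) + e
-- abstracted so that the ring solver treats it as a variable; it enters only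
-- through the first hypothesis.  The proof multiplies by N (d + 1) and adds
-- (N + 1) e (d + 1) c to both sides, so that no subtraction occurs.
ballot-step : ∀ {N d e A B a c} .{{_ : ℕ.NonZero N}} →
  e * suc N + suc d * suc (suc e) ≡ suc e * N + e * suc d →
  A * N ≡ e * a → B * N ≡ suc (suc e) * c → suc d * (c + a) ≡ suc N * c →
  (A + B) * suc N ≡ suc e * (c + a)
ballot-step {N} {d} {e} {A} {B} {a} {c} numerology A·N B·N absorb =
  ℕ.*-cancelʳ-≡ _ _ (N * suc d) {{ℕ.m*n≢0 N (suc d)}}
    (ℕ.+-cancelʳ-≡ (suc N * e * (suc d * c)) _ _ (begin
      (A + B) * suc N * (N * suc d) + suc N * e * (suc d * c)
        ≡⟨ solveℕ (A ∷ B ∷ N ∷ d ∷ e ∷ c ∷ []) ⟩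
      suc N * suc d * (A * N) + suc N * suc d * (B * N) + suc N * e * (suc d * c)
        ≡⟨ ≡.cong₂ (λ p q → suc N * suc d * p + suc N * suc d * q + suc N * e * (suc d * c)) A·N B·N ⟩
      suc N * suc d * (e * a) + suc N * suc d * (suc (suc e) * c) + suc N * e * (suc d * c)
        ≡⟨ solveℕ (N ∷ d ∷ e ∷ a ∷ c ∷ []) ⟩
      suc N * e * (suc d * (c + a)) + suc N * suc d * (suc (suc e) * c)
        ≡⟨ ≡.cong (λ p → suc N * e * p + suc N * suc d * (suc (suc e) * c)) absorb ⟩
      suc N * e * (suc N * c) + suc N * suc d * (suc (suc e) * c)
        ≡⟨ solveℕ (N ∷ d ∷ e ∷ c ∷ []) ⟩
      suc N * c * (e * suc N + suc d * suc (suc e))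
        ≡⟨ ≡.cong (suc N * c *_) numerology ⟩
      suc N * c * (suc e * N + e * suc d)
        ≡⟨ solveℕ (N ∷ d ∷ e ∷ c ∷ []) ⟩
      suc e * N * (suc N * c) + suc N * e * (suc d * c)
        ≡⟨ ≡.cong (λ p → suc e * N * p + suc N * e * (suc d * c)) absorb ⟨
      suc e * N * (suc d * (c + a)) + suc N * e * (suc d * c)
        ≡⟨ solveℕ (N ∷ d ∷ e ∷ a ∷ c ∷ []) ⟩
      suc e * (c + a) * (N * suc d) + suc N * e * (suc d * c)
        ∎))
  where open ≡.≡-Reasoning

ballot-closed-form : ∀ d e → ballot d e * (2 * d + e) ≡ e * ((2 * d + e) C d)
ballot-closed-form zero    e       = ℕ.*-comm 1 e
ballot-closed-form (suc d) zero    = ≡.refl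
ballot-closed-form (suc d) (suc e) =
  ≡.subst (λ M → ballot (suc d) (suc e) * M ≡ suc e * (M C suc d)) (≡.sym (ℕ.+-suc (2 * suc d) e))
    (≡.trans
      (ballot-step {N} {d} {e} {ballot (suc d) e} {ballot d (suc (suc e))} numerology
        (ballot-closed-form (suc d) e)
        (≡.subst (λ M → ballot d (suc (suc e)) * M ≡ suc (suc e) * (M C d)) same-width
          (ballot-closed-form d (suc (suc e))))
        (≡.trans (≡.cong (suc d *_) (pascal N d)) (absorption N d)))
      (≡.cong (suc e *_) (pascal N d)))
  where
  N = 2 * suc d + e
  pascal = nCk+nC[k+1]≡[n+1]C[k+1]
  same-width : 2 * d + suc (suc e) ≡ 2 * suc d + e
  same-width = solveℕ (d ∷ e ∷ [])
  numerology : e * suc (2 * suc d + e) + suc d * suc (suc e)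
             ≡ suc e * (2 * suc d + e) + e * suc d
  numerology = solveℕ (d ∷ e ∷ [])

-- Stanley polyominoes

-- The coordinates are explicit: they cannot be recovered from the type of
-- the proof once chain has reduced to a conjunction.
chain-∷⁻ : ∀ s e s′ e′ rs → T (chain (s , e) ((s′ , e′) ∷ rs)) →
           s < s′ × s′ ≤ e × e < e′ × T (chain (s′ , e′) rs)
chain-∷⁻ s e s′ e′ rs p =
  let s<s′ , p = Equivalence.to T-∧ p
      s′≤e , p = Equivalence.to T-∧ p
      e<e′ , p = Equivalence.to T-∧ p
      _    , p = Equivalence.to T-∧ p
  in ℕ.<ᵇ⇒< s s′ s<s′ , ℕ.≤ᵇ⇒≤ s′ e s′≤e , ℕ.<ᵇ⇒< e e′ e<e′ , p

chain-∷⁺ : ∀ s e s′ e′ rs → s < s′ → s′ ≤ e → e < e′ → T (chain (s′ , e′) rs) →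
           T (chain (s , e) ((s′ , e′) ∷ rs))
chain-∷⁺ s e s′ e′ rs s<s′ s′≤e e<e′ p =
  ∧-intro (ℕ.<⇒<ᵇ s<s′) (∧-intro (ℕ.≤⇒≤ᵇ s′≤e) (∧-intro (ℕ.<⇒<ᵇ e<e′)
    (∧-intro (ℕ.≤⇒≤ᵇ (ℕ.≤-trans s′≤e (ℕ.<⇒≤ e<e′))) p)))
  where
  ∧-intro : ∀ {x y} → T x → T y → T (x ∧ y)
  ∧-intro p q = Equivalence.from T-∧ (p , q)

chain-lower-start : ∀ {s s′ e} rs → s′ ≤ s → T (chain (s , e) rs) → T (chain (s′ , e) rs)
chain-lower-start                []                _    _ = _
chain-lower-start {s} {s′} {e} ((s″ , e″) ∷ rs) s′≤s p =
  let s<s″ , s″≤e , e<e″ , q = chain-∷⁻ s e s″ e″ rs p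
  in chain-∷⁺ s′ e s″ e″ rs (ℕ.≤-<-trans s′≤s s<s″) s″≤e e<e″ q

lastE-start : ∀ s s′ e rs → lastE (s , e) rs ≡ lastE (s′ , e) rs
lastE-start s s′ e []       = ≡.refl
lastE-start s s′ e (r ∷ rs) = ≡.refl

lastE-≥ : ∀ {s e} rs → T (chain (s , e) rs) → e ≤ lastE (s , e) rs
lastE-≥         []                _ = ℕ.≤-refl
lastE-≥ {s} {e} ((s′ , e′) ∷ rs) p =
  let _ , _ , e<e′ , q = chain-∷⁻ s e s′ e′ rs p in ℕ.≤-trans (ℕ.<⇒≤ e<e′) (lastE-≥ rs q)

chain-over-0 : ∀ {s} rs → T (chain (s , 0) rs) → rs ≡ []
chain-over-0     []                _ = ≡.refl
chain-over-0 {s} ((s′ , e′) ∷ rs) p =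
  let s<s′ , s′≤0 , _ = chain-∷⁻ s 0 s′ e′ rs p in ⊥-elim (ℕ.<⇒≱ s<s′ (ℕ.≤-trans s′≤0 z≤n))

shift unshift : List Row → List Row
shift   = List.map (Product.map suc suc)
unshift = List.map (Product.map ℕ.pred ℕ.pred)

unshift-shift : ∀ rs → unshift (shift rs) ≡ rs
unshift-shift []       = ≡.refl
unshift-shift (r ∷ rs) = ≡.cong (r ∷_) (unshift-shift rs)

shift-unshift : ∀ {s e} rs → T (chain (s , e) rs) → shift (unshift rs) ≡ rs
shift-unshift         []                       _ = ≡.refl
shift-unshift {s} {e} ((zero , e′) ∷ rs)       p = ⊥-elim (ℕ.n≮0 (proj₁ (chain-∷⁻ s e 0 e′ rs p)))
shift-unshift {s} {e} ((suc s′ , zero) ∷ rs)   p =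
  let _ , _ , e<0 , _ = chain-∷⁻ s e (suc s′) 0 rs p in ⊥-elim (ℕ.n≮0 e<0)
shift-unshift {s} {e} ((suc s′ , suc e′) ∷ rs) p =
  let _ , _ , _ , q = chain-∷⁻ s e (suc s′) (suc e′) rs p
  in ≡.cong ((suc s′ , suc e′) ∷_) (shift-unshift rs q)

<ᵇ-suc : ∀ m n → (m ℕ.<ᵇ suc n) ≡ (m ℕ.≤ᵇ n)
<ᵇ-suc zero    n = ≡.refl
<ᵇ-suc (suc m) n = ≡.refl

chain-shift : ∀ s e rs → chain (suc s , suc e) (shift rs) ≡ chain (s , e) rs
chain-shift s e []                = ≡.refl
chain-shift s e ((s′ , e′) ∷ rs)
  rewrite <ᵇ-suc s′ e | <ᵇ-suc s′ e′ | chain-shift s′ e′ rs = ≡.refl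

lastE-shift : ∀ s e rs → lastE (suc s , suc e) (shift rs) ≡ suc (lastE (s , e) rs)
lastE-shift s e []                = ≡.refl
lastE-shift s e ((s′ , e′) ∷ rs) = lastE-shift s′ e′ rs

shift-chain : ∀ s e rs → T (chain (s , e) rs) → T (chain (suc s , suc e) (shift rs))
shift-chain s e rs = ≡.subst T (≡.sym (chain-shift s e rs))

unshift-chain : ∀ s e rs → T (chain (suc s , suc e) rs) → T (chain (s , e) (unshift rs))
unshift-chain s e rs p =
  ≡.subst T (≡.trans (≡.cong (chain (suc s , suc e)) (≡.sym (shift-unshift rs p))) (chain-shift s e (unshift rs))) p

lastE-unshift : ∀ s e rs → T (chain (suc s , suc e) rs) → suc (lastE (s , e) (unshift rs)) ≡ lastE (suc s , suc e) rs
lastE-unshift s e rs p =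
  ≡.trans (≡.sym (lastE-shift s e (unshift rs))) (≡.cong (lastE (suc s , suc e)) (shift-unshift rs p))

Chain : ℕ → ℕ → Set
Chain e m = Σ (List Row) λ rs → T (chain (0 , e) rs) × lastE (0 , e) rs ≡ m

Chain-≡ : ∀ {e m} {x y : Chain e m} → proj₁ x ≡ proj₁ y → x ≡ y
Chain-≡ {x = rs , p , q} {.rs , p′ , q′} ≡.refl =
  ≡.cong₂ (λ p q → rs , p , q) (T-irrelevant p p′) (ℕ.≡-irrelevant q q′)

stanley↔chain : ∀ m e → StanleyWith (suc m) (suc e) ↔ Chain e m
stanley↔chain m e = mk↔ₛ′ to from (λ _ → Chain-≡ ≡.refl) from∘to
  where
  to : StanleyWith (suc m) (suc e) → Chain e m
  to (((zero , .e) ∷ rs) , p , col≡ , ≡.refl) = rs , p , ℕ.suc-injective col≡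
  from : Chain e m → StanleyWith (suc m) (suc e)
  from (rs , p , q) = ((0 , e) ∷ rs) , p , ≡.cong suc q , ≡.refl
  from∘to : ∀ x → from (to x) ≡ x
  from∘to (((zero , .e) ∷ rs) , p , col≡ , ≡.refl) =
    ≡.cong (λ col≡ → ((0 , e) ∷ rs) , p , col≡ , ≡.refl) (ℕ.≡-irrelevant _ _)

no-stanley-without-columns : ∀ {k} → ¬ StanleyWith 0 k
no-stanley-without-columns (((zero , e) ∷ rs) , _ , () , _)

no-stanley-with-empty-first-row : ∀ {n} → ¬ StanleyWith n 0
no-stanley-with-empty-first-row (((zero , e) ∷ rs) , _ , _ , ())

chain-0-0 : ∀ (x : Chain 0 0) → x ≡ ([] , _ , ≡.refl)
chain-0-0 (rs , p , q) = Chain-≡ (chain-over-0 rs p)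

no-chain-0-suc : ∀ {m} → ¬ Chain 0 (suc m)
no-chain-0-suc (rs , p , q) with chain-over-0 rs p
no-chain-0-suc ([] , p , ()) | ≡.refl

no-chain-below-diagonal : ∀ {m e} → m < e → ¬ Chain e m
no-chain-below-diagonal m<e (rs , p , ≡.refl) = ℕ.<⇒≱ m<e (lastE-≥ rs p)

-- A chain above (0 , k + 1) whose next row starts in column 2 or later (or
-- which is empty) loses its leftmost column.  A next row (1 , e′) is kept
-- above the longer bottom row (0 , k + 2) if e′ > k + 2, and merged into it
-- if e′ = k + 2.
module ChainSplit (k n : ℕ) where

  split : Chain (suc k) (suc n) → Chain k n ⊎ Chain (suc (suc k)) (suc n)
  split ([] , _ , q) = inj₁ ([] , _ , ℕ.suc-injective q)
  split (((1 , e′) ∷ rs) , p , q) with e′ ℕ.≟ suc (suc k)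
  ... | yes ≡.refl =
    let _ , _ , _ , rest = chain-∷⁻ 0 (suc k) 1 e′ rs p
    in inj₂ (rs , chain-lower-start rs z≤n rest , ≡.trans (lastE-start 0 1 e′ rs) q)
  ... | no e′≢k+2 =
    let _ , _ , k+1<e′ , rest = chain-∷⁻ 0 (suc k) 1 e′ rs p
        k+2<e′ = ℕ.≤∧≢⇒< k+1<e′ (e′≢k+2 ∘ ≡.sym)
    in inj₂ (((1 , e′) ∷ rs) , chain-∷⁺ 0 (suc (suc k)) 1 e′ rs z<s (s≤s z≤n) k+2<e′ rest , q)
  split (((suc (suc s) , e′) ∷ rs) , p , q) =
    inj₁ (unshift rs′ , unshift-chain 0 k rs′ above-1 ,
          ℕ.suc-injective (≡.trans (lastE-unshift 0 k rs′ above-1) q))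
    where
    rs′ = (suc (suc s) , e′) ∷ rs
    above-1 : T (chain (1 , suc k) rs′)
    above-1 = let _ , s≤k , k<e′ , rest = chain-∷⁻ 0 (suc k) (suc (suc s)) e′ rs p
              in chain-∷⁺ 1 (suc k) (suc (suc s)) e′ rs (s≤s (s≤s z≤n)) s≤k k<e′ rest

  unsplit : Chain k n ⊎ Chain (suc (suc k)) (suc n) → Chain (suc k) (suc n)
  unsplit (inj₁ (rs , p , q)) =
    shift rs , chain-lower-start (shift rs) z≤n (shift-chain 0 k rs p) ,
    ≡.trans (lastE-start 0 1 (suc k) (shift rs)) (≡.trans (lastE-shift 0 k rs) (≡.cong suc q))
  unsplit (inj₂ ([] , _ , q)) =
    ((1 , suc (suc k)) ∷ []) , chain-∷⁺ 0 (suc k) 1 (suc (suc k)) [] z<s (s≤s z≤n) (ℕ.n<1+n (suc k)) _ , q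
  unsplit (inj₂ (((1 , e′) ∷ rs) , p , q)) =
    let _ , _ , k+2<e′ , rest = chain-∷⁻ 0 (suc (suc k)) 1 e′ rs p
        k+1<e′ = ℕ.<-trans (ℕ.n<1+n (suc k)) k+2<e′
    in ((1 , e′) ∷ rs) , chain-∷⁺ 0 (suc k) 1 e′ rs z<s (s≤s z≤n) k+1<e′ rest , q
  unsplit (inj₂ (((suc (suc s) , e′) ∷ rs) , p , q)) =
    let _ , s≤k+2 , k+2<e′ , rest = chain-∷⁻ 0 (suc (suc k)) (suc (suc s)) e′ rs p
    in ((1 , suc (suc k)) ∷ (suc (suc s) , e′) ∷ rs) ,
       chain-∷⁺ 0 (suc k) 1 (suc (suc k)) ((suc (suc s) , e′) ∷ rs) z<s (s≤s z≤n) (ℕ.n<1+n (suc k))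
         (chain-∷⁺ 1 (suc (suc k)) (suc (suc s)) e′ rs (s≤s (s≤s z≤n)) s≤k+2 k+2<e′ rest) , q

  split-unsplit : ∀ y → split (unsplit y) ≡ y
  split-unsplit (inj₁ ([] , _ , _)) = ≡.cong inj₁ (Chain-≡ ≡.refl)
  split-unsplit (inj₁ (((suc s , e′) ∷ rs) , _ , _)) = ≡.cong inj₁ (Chain-≡ (unshift-shift ((suc s , e′) ∷ rs)))
  split-unsplit (inj₂ ([] , _ , _)) with suc (suc k) ℕ.≟ suc (suc k)
  ... | yes ≡.refl = ≡.cong inj₂ (Chain-≡ ≡.refl)
  ... | no k+2≢k+2 = ⊥-elim (k+2≢k+2 ≡.refl)
  split-unsplit (inj₂ (((1 , e′) ∷ rs) , p , _)) with e′ ℕ.≟ suc (suc k)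
  ... | yes ≡.refl =
    let _ , _ , k+2<k+2 , _ = chain-∷⁻ 0 (suc (suc k)) 1 e′ rs p in ⊥-elim (ℕ.<-irrefl ≡.refl k+2<k+2)
  ... | no _       = ≡.cong inj₂ (Chain-≡ ≡.refl)
  split-unsplit (inj₂ (((suc (suc s) , e′) ∷ rs) , _ , _)) with suc (suc k) ℕ.≟ suc (suc k)
  ... | yes ≡.refl = ≡.cong inj₂ (Chain-≡ ≡.refl)
  ... | no k+2≢k+2 = ⊥-elim (k+2≢k+2 ≡.refl)

  third-row-start : ∀ e′ s e″ rs → T (chain (0 , suc k) ((1 , e′) ∷ (s , e″) ∷ rs)) → 1 < s
  third-row-start e′ s e″ rs p =
    let _ , _ , _ , q = chain-∷⁻ 0 (suc k) 1 e′ ((s , e″) ∷ rs) p in proj₁ (chain-∷⁻ 1 e′ s e″ rs q)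

  unsplit-split : ∀ x → unsplit (split x) ≡ x
  unsplit-split ([] , _ , _) = Chain-≡ ≡.refl
  unsplit-split (((1 , e′) ∷ rs) , p , q) with e′ ℕ.≟ suc (suc k)
  unsplit-split (((1 , e′) ∷ []) , p , q) | yes ≡.refl = Chain-≡ ≡.refl
  unsplit-split (((1 , e′) ∷ (zero , e″) ∷ rs) , p , q) | yes ≡.refl =
    ⊥-elim (ℕ.n≮0 (third-row-start e′ 0 e″ rs p))
  unsplit-split (((1 , e′) ∷ (1 , e″) ∷ rs) , p , q) | yes ≡.refl =
    ⊥-elim (ℕ.<-irrefl ≡.refl (third-row-start e′ 1 e″ rs p))
  unsplit-split (((1 , e′) ∷ (suc (suc s) , e″) ∷ rs) , p , q) | yes ≡.refl = Chain-≡ ≡.refl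
  unsplit-split (((1 , e′) ∷ rs) , p , q) | no _ = Chain-≡ ≡.refl
  unsplit-split (((suc (suc s) , e′) ∷ rs) , p , q) =
    Chain-≡ (shift-unshift {0} {suc k} ((suc (suc s) , e′) ∷ rs) p)

chain-split : ∀ k n → Chain (suc k) (suc n) ↔ (Chain k n ⊎ Chain (suc (suc k)) (suc n))
chain-split k n = mk↔ₛ′ split unsplit split-unsplit unsplit-split
  where open ChainSplit k n

empty⇒card≡0 : ∀ {n} {A : Set} → Fin n ↔ A → ¬ A → n ≡ 0
empty⇒card≡0 {zero}  _ _  = ≡.refl
empty⇒card≡0 {suc n} f ¬A = ⊥-elim (¬A (Inverse.to f Fin.zero))

singleton⇒card≡1 : ∀ {n} {A : Set} → Fin n ↔ A → (a : A) → (∀ x → x ≡ a) → n ≡ 1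
singleton⇒card≡1 f a unique = ↔⇒≡ (↔-trans f (↔-sym single))
  where
  single : Fin 1 ↔ _
  single = mk↔ₛ′ (λ _ → a) (λ _ → Fin.zero) (λ x → ≡.sym (unique x))
                 (λ { Fin.zero → ≡.refl ; (Fin.suc ()) })

⊎⇒card≡+ : ∀ {n a b} {A B : Set} → Fin n ↔ (A ⊎ B) → Fin a ↔ A → Fin b ↔ B → n ≡ a + b
⊎⇒card≡+ {a = a} f fa fb = ↔⇒≡ (↔-trans f (↔-sym (↔-trans (Fin.+↔⊎ {a}) (fa ⊎-↔ fb))))

module StanleyCount (g : ℕ → ℕ → ℕ) (count : ∀ n k → Fin (g n k) ↔ StanleyWith n k) where

  count-chains : ∀ m e → Fin (g (suc m) (suc e)) ↔ Chain e m
  count-chains m e = ↔-trans (count (suc m) (suc e)) (stanley↔chain m e)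

  chain-counts : IsBallotTable (λ m e → + g (suc m) (suc e))
  chain-counts = record
    { corner         = ≡.cong +_ (singleton⇒card≡1 (count-chains 0 0) _ chain-0-0)
    ; left-column    = λ m → ≡.cong +_ (empty⇒card≡0 (count-chains (suc m) 0) no-chain-0-suc)
    ; below-diagonal = λ m<e → ≡.cong +_ (empty⇒card≡0 (count-chains _ _) (no-chain-below-diagonal m<e))
    ; recurrence     = λ m e → ≡.cong +_ (⊎⇒card≡+ (↔-trans (count-chains (suc m) (suc e)) (chain-split e m))
                                                   (count-chains m e) (count-chains (suc m) (suc (suc e))))
    }

  no-columns : ∀ k → g 0 k ≡ 0
  no-columns k = empty⇒card≡0 (count 0 k) no-stanley-without-columns

  empty-first-row : ∀ n → g n 0 ≡ 0
  empty-first-row n = empty⇒card≡0 (count n 0) no-stanley-with-empty-first-row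

  g≡ballot : ∀ d e → g (suc (d + e)) (suc e) ≡ ballot d e
  g≡ballot d e = ℤ.+-injective (IsBallotTable.ballot-entry chain-counts d e)

  closed-form : ∀ n k → 1 ≤ k → k ≤ n →
                g n k * (2 * n ∸ k ∸ 1) ≡ (k ∸ 1) * ((2 * n ∸ k ∸ 1) C (n ∸ k))
  closed-form (suc m) (suc e) _ (s≤s e≤m) =
    ≡.subst (λ m → g (suc m) (suc e) * (2 * suc m ∸ suc e ∸ 1) ≡ e * ((2 * suc m ∸ suc e ∸ 1) C (m ∸ e)))
      (ℕ.m∸n+n≡m e≤m) (at-distance (m ∸ e))
    where
    width : ∀ d → 2 * suc (d + e) ∸ suc e ∸ 1 ≡ 2 * d + e
    width d = ≡.trans (≡.cong (λ w → w ∸ suc e ∸ 1) expand)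
                      (≡.cong (_∸ 1) (ℕ.m+n∸m≡n (suc e) (suc (2 * d + e))))
      where
      expand : 2 * suc (d + e) ≡ suc e + suc (2 * d + e)
      expand = solveℕ (d ∷ e ∷ [])
    at-distance : ∀ d → g (suc (d + e)) (suc e) * (2 * suc (d + e) ∸ suc e ∸ 1)
                        ≡ e * ((2 * suc (d + e) ∸ suc e ∸ 1) C (d + e ∸ e))
    at-distance d = begin
      g (suc (d + e)) (suc e) * (2 * suc (d + e) ∸ suc e ∸ 1) ≡⟨ ≡.cong₂ _*_ (g≡ballot d e) (width d) ⟩
      ballot d e * (2 * d + e)                                   ≡⟨ ballot-closed-form d e ⟩
      e * ((2 * d + e) C d)                                      ≡⟨ ≡.cong₂ (λ w j → e * (w C j)) (width d) (ℕ.m+n∸n≡m d e) ⟨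
      e * ((2 * suc (d + e) ∸ suc e ∸ 1) C (d + e ∸ e))         ∎
      where open ≡.≡-Reasoning

-- The generating function

module SquareRoot (S r T : Ser) (onlyX-S : OnlyX S)
  (S²≐1-4X : S ⊗ S ≐ cst (+ 1) ⊖ cst (+ 4) ⊗ X)
  (2Xr≐1-S : cst (+ 2) ⊗ X ⊗ r ≐ cst (+ 1) ⊖ S)
  (2T≐1+S : cst (+ 2) ⊗ T ≐ cst (+ 1) ⊕ S) where

  P : Ser
  P = r ⊗ X

  T≐1-P : T ≐ cst (+ 1) ⊖ P
  T≐1-P = cst-⊗-cancel (+ 2) (begin
    cst (+ 2) ⊗ T
      ≈⟨ 2T≐1+S ⟩
    cst (+ 1) ⊕ S
      ≈⟨ solve 1 (λ s → con (+ 1) :+ s := con (+ 2) :- (con (+ 1) :- s)) ≐-refl S ⟩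
    cst (+ 2) ⊖ (cst (+ 1) ⊖ S)
      ≈⟨ ⊖-cong (≐-refl {cst (+ 2)}) 2Xr≐1-S ⟨
    cst (+ 2) ⊖ cst (+ 2) ⊗ X ⊗ r
      ≈⟨ solve 2 (λ x r → con (+ 2) :- con (+ 2) :* x :* r := con (+ 2) :* (con (+ 1) :- r :* x)) ≐-refl X r ⟩
    cst (+ 2) ⊗ (cst (+ 1) ⊖ P)
      ∎)
    where open ≐-Reasoning

  r⊗T≐1 : r ⊗ T ≐ cst (+ 1)
  r⊗T≐1 = X-⊗-cancel (cst-⊗-cancel (+ 4) (begin
    cst (+ 4) ⊗ (X ⊗ (r ⊗ T))
      ≈⟨ solve 3 (λ x r t → con (+ 4) :* (x :* (r :* t)) := (con (+ 2) :* x :* r) :* (con (+ 2) :* t))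
                 ≐-refl X r T ⟩
    (cst (+ 2) ⊗ X ⊗ r) ⊗ (cst (+ 2) ⊗ T)
      ≈⟨ ⊗-cong 2Xr≐1-S 2T≐1+S ⟩
    (cst (+ 1) ⊖ S) ⊗ (cst (+ 1) ⊕ S)
      ≈⟨ solve 1 (λ s → (con (+ 1) :- s) :* (con (+ 1) :+ s) := con (+ 1) :- s :* s) ≐-refl S ⟩
    cst (+ 1) ⊖ S ⊗ S
      ≈⟨ ⊖-cong (≐-refl {cst (+ 1)}) S²≐1-4X ⟩
    cst (+ 1) ⊖ (cst (+ 1) ⊖ cst (+ 4) ⊗ X)
      ≈⟨ solve 1 (λ x → con (+ 1) :- (con (+ 1) :- con (+ 4) :* x) := con (+ 4) :* (x :* con (+ 1))) ≐-refl X ⟩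
    cst (+ 4) ⊗ (X ⊗ cst (+ 1))
      ∎))
    where open ≐-Reasoning

  r⊗[1-P]≐1 : r ⊗ (cst (+ 1) ⊖ P) ≐ cst (+ 1)
  r⊗[1-P]≐1 = begin
    r ⊗ (cst (+ 1) ⊖ P)    ≈⟨ ⊗-cong (≐-refl {r}) T≐1-P ⟨
    r ⊗ T                  ≈⟨ r⊗T≐1 ⟩
    cst (+ 1)              ∎
    where open ≐-Reasoning

  catalan : P ≐ X ⊕ P ⊗ P
  catalan = begin
    r ⊗ X
      ≈⟨ solve 2 (λ r x → r :* x := x :* (r :* (con (+ 1) :- r :* x)) :+ (r :* x) :* (r :* x)) ≐-refl r X ⟩
    X ⊗ (r ⊗ (cst (+ 1) ⊖ P)) ⊕ P ⊗ P
      ≈⟨ ⊕-cong (⊗-cong (≐-refl {X}) r⊗[1-P]≐1) (≐-refl {P ⊗ P}) ⟩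
    X ⊗ cst (+ 1) ⊕ P ⊗ P
      ≈⟨ solve 2 (λ p x → x :* con (+ 1) :+ p :* p := x :+ p :* p) ≐-refl P X ⟩
    X ⊕ P ⊗ P
      ∎
    where open ≐-Reasoning

  onlyX-r : OnlyX r
  onlyX-r n k = ℤ.*-cancelˡ-≡ (+ 2) (r n (suc k)) (+ 0) (begin
    + 2 ℤ.* r n (suc k)                          ≡⟨ ≡.cong (+ 2 ℤ.*_) (X-⊗-suc r n (suc k)) ⟨
    + 2 ℤ.* (X ⊗ r) (suc n) (suc k)              ≡⟨ cst-⊗ (+ 2) (X ⊗ r) (suc n) (suc k) ⟨
    (cst (+ 2) ⊗ (X ⊗ r)) (suc n) (suc k)        ≡⟨ reassociate (suc n) (suc k) ⟩
    (cst (+ 2) ⊗ X ⊗ r) (suc n) (suc k)          ≡⟨ 2Xr≐1-S (suc n) (suc k) ⟩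
    + 0 ℤ.+ ℤ.- S (suc n) (suc k)                ≡⟨ ≡.cong (λ s → + 0 ℤ.+ ℤ.- s) (onlyX-S (suc n) k) ⟩
    + 0                                          ∎)
    where
    open ≡.≡-Reasoning
    reassociate : cst (+ 2) ⊗ (X ⊗ r) ≐ cst (+ 2) ⊗ X ⊗ r
    reassociate = solve 2 (λ x r → con (+ 2) :* (x :* r) := con (+ 2) :* x :* r) ≐-refl X r

  onlyX-P : OnlyX P
  onlyX-P = onlyX-⊗-closed {r} {X} onlyX-r onlyX-X

  kernel-factorisation : cst (+ 2) ⊗ U ⊗ U ⊗ X ⊖ cst (+ 2) ⊗ U ⊕ cst (+ 2)
                       ≐ (cst (+ 1) ⊖ P ⊗ U) ⊗ (cst (+ 2) ⊖ cst (+ 2) ⊗ T ⊗ U)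
  kernel-factorisation = begin
    cst (+ 2) ⊗ U ⊗ U ⊗ X ⊖ cst (+ 2) ⊗ U ⊕ cst (+ 2)
      ≈⟨ ⊕-cong (⊖-cong (⊗-cong (≐-refl {cst (+ 2) ⊗ U ⊗ U}) X≐P-P²) (≐-refl {cst (+ 2) ⊗ U}))
                (≐-refl {cst (+ 2)}) ⟩
    cst (+ 2) ⊗ U ⊗ U ⊗ (P ⊖ P ⊗ P) ⊖ cst (+ 2) ⊗ U ⊕ cst (+ 2)
      ≈⟨ solve 2 (λ p u → con (+ 2) :* u :* u :* (p :- p :* p) :- con (+ 2) :* u :+ con (+ 2)
                     := (con (+ 1) :- p :* u) :* (con (+ 2) :- con (+ 2) :* (con (+ 1) :- p) :* u))
                 ≐-refl P U ⟩
    (cst (+ 1) ⊖ P ⊗ U) ⊗ (cst (+ 2) ⊖ cst (+ 2) ⊗ (cst (+ 1) ⊖ P) ⊗ U)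
      ≈⟨ ⊗-cong (≐-refl {cst (+ 1) ⊖ P ⊗ U})
                (⊖-cong (≐-refl {cst (+ 2)}) (⊗-cong (⊗-cong (≐-refl {cst (+ 2)}) T≐1-P) (≐-refl {U}))) ⟨
    (cst (+ 1) ⊖ P ⊗ U) ⊗ (cst (+ 2) ⊖ cst (+ 2) ⊗ T ⊗ U)
      ∎
    where
    open ≐-Reasoning
    X≐P-P² : X ≐ P ⊖ P ⊗ P
    X≐P-P² = begin
      X                    ≈⟨ solve 2 (λ x p → x := x :+ p :* p :- p :* p) ≐-refl X P ⟩
      X ⊕ P ⊗ P ⊖ P ⊗ P    ≈⟨ ⊖-cong catalan (≐-refl {P ⊗ P}) ⟨
      P ⊖ P ⊗ P            ∎

  P-power-step : ∀ e → P ^ˢ suc e ≐ X ⊗ P ^ˢ e ⊕ P ^ˢ suc (suc e)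
  P-power-step e = begin
    P ⊗ P ^ˢ e
      ≈⟨ ⊗-cong catalan (≐-refl {P ^ˢ e}) ⟩
    (X ⊕ P ⊗ P) ⊗ P ^ˢ e
      ≈⟨ solve 3 (λ x p y → (x :+ p :* p) :* y := x :* y :+ p :* (p :* y)) ≐-refl X P (P ^ˢ e) ⟩
    X ⊗ P ^ˢ e ⊕ P ⊗ (P ⊗ P ^ˢ e)
      ∎
    where open ≐-Reasoning

  P-power-factor : ∀ e → P ^ˢ suc e ≐ X ⊗ (r ⊗ P ^ˢ e)
  P-power-factor e = solve 3 (λ r x y → r :* x :* y := x :* (r :* y)) ≐-refl r X (P ^ˢ e)

  P-power-below-diagonal : ∀ {m e} → m < e → (P ^ˢ e) m 0 ≡ + 0
  P-power-below-diagonal {zero}  {suc e} _         =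
    ≡.trans (P-power-factor e 0 0) (X-⊗-zero (r ⊗ P ^ˢ e) 0)
  P-power-below-diagonal {suc m} {suc e} (s≤s m<e) = begin
    (P ^ˢ suc e) (suc m) 0                             ≡⟨ P-power-factor e (suc m) 0 ⟩
    (X ⊗ (r ⊗ P ^ˢ e)) (suc m) 0                       ≡⟨ X-⊗-suc (r ⊗ P ^ˢ e) m 0 ⟩
    sumTo m (λ i → r i 0 ℤ.* (P ^ˢ e) (m ∸ i) 0)       ≡⟨ sumTo-zero m vanishes ⟩
    + 0                                                ∎
    where
    open ≡.≡-Reasoning
    vanishes : ∀ i → r i 0 ℤ.* (P ^ˢ e) (m ∸ i) 0 ≡ + 0
    vanishes i = ≡.trans (≡.cong (r i 0 ℤ.*_) (P-power-below-diagonal (ℕ.≤-<-trans (ℕ.m∸n≤m m i) m<e)))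
                         (ℤ.*-zeroʳ (r i 0))

  P-powers : IsBallotTable (λ m e → (P ^ˢ e) m 0)
  P-powers = record
    { corner         = ≡.refl
    ; left-column    = λ m → ≡.refl
    ; below-diagonal = P-power-below-diagonal
    ; recurrence     = λ m e → ≡.trans (P-power-step e (suc m) 0)
                                        (≡.cong (ℤ._+ (P ^ˢ suc (suc e)) (suc m) 0) (X-⊗-suc (P ^ˢ e) m 0))
    }

module GeneratingFunction
  (g : ℕ → ℕ → ℕ) (count : ∀ n k → Fin (g n k) ↔ StanleyWith n k)
  (S r T : Ser) (onlyX-S : OnlyX S)
  (S²≐1-4X : S ⊗ S ≐ cst (+ 1) ⊖ cst (+ 4) ⊗ X)
  (2Xr≐1-S : cst (+ 2) ⊗ X ⊗ r ≐ cst (+ 1) ⊖ S)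
  (2T≐1+S : cst (+ 2) ⊗ T ≐ cst (+ 1) ⊕ S) where

  open StanleyCount g count public using (closed-form)
  open StanleyCount g count using (chain-counts; no-columns; empty-first-row)
  open SquareRoot S r T onlyX-S S²≐1-4X 2Xr≐1-S 2T≐1+S

  G : Ser
  G n k = + g n k

  u-coefficient : ∀ k n → G n (suc k) ≡ (X ⊗ P ^ˢ k) n 0
  u-coefficient k zero    = ≡.trans (≡.cong +_ (no-columns (suc k))) (≡.sym (X-⊗-zero (P ^ˢ k) 0))
  u-coefficient k (suc m) = ≡.trans (ballot-tables-agree chain-counts P-powers m k) (≡.sym (X-⊗-suc (P ^ˢ k) m 0))

  G-recursion : G ≐ (X ⊕ P ⊗ G) ⊗ U
  G-recursion n zero    = ≡.trans (≡.cong +_ (empty-first-row n)) (≡.sym (⊗-U-zero (X ⊕ P ⊗ G) n))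
  G-recursion n (suc k) = ≡.trans (row k) (≡.sym (⊗-U-suc (X ⊕ P ⊗ G) n k))
    where
    open ≡.≡-Reasoning
    row : ∀ k → G n (suc k) ≡ X n k ℤ.+ (P ⊗ G) n k
    row zero = begin
      G n 1                                    ≡⟨ u-coefficient 0 n ⟩
      (X ⊗ cst (+ 1)) n 0                      ≡⟨ solve 1 (λ x → x :* con (+ 1) := x) ≐-refl X n 0 ⟩
      X n 0                                    ≡⟨ ℤ.+-identityʳ (X n 0) ⟨
      X n 0 ℤ.+ + 0                            ≡⟨ ≡.cong (λ z → X n 0 ℤ.+ z) (sumTo-zero n vanishes) ⟨
      X n 0 ℤ.+ (P ⊗ G) n 0                    ∎
      where
      vanishes : ∀ i → P i 0 ℤ.* G (n ∸ i) 0 ≡ + 0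
      vanishes i = ≡.trans (≡.cong (λ c → P i 0 ℤ.* + c) (empty-first-row (n ∸ i))) (ℤ.*-zeroʳ (P i 0))
    row (suc k) = begin
      G n (suc (suc k))
        ≡⟨ u-coefficient (suc k) n ⟩
      (X ⊗ (P ⊗ P ^ˢ k)) n 0
        ≡⟨ solve 3 (λ x p y → x :* (p :* y) := p :* (x :* y)) ≐-refl X P (P ^ˢ k) n 0 ⟩
      sumTo n (λ i → P i 0 ℤ.* (X ⊗ P ^ˢ k) (n ∸ i) 0)
        ≡⟨ sumTo-cong n (λ i → ≡.cong (P i 0 ℤ.*_) (u-coefficient k (n ∸ i))) ⟨
      sumTo n (λ i → P i 0 ℤ.* G (n ∸ i) (suc k))
        ≡⟨ onlyX-⊗ {P} onlyX-P G n (suc k) ⟨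
      (P ⊗ G) n (suc k)
        ≡⟨ ℤ.+-identityˡ _ ⟨
      + 0 ℤ.+ (P ⊗ G) n (suc k)
        ≡⟨ ≡.cong (ℤ._+ (P ⊗ G) n (suc k)) (onlyX-X n k) ⟨
      X n (suc k) ℤ.+ (P ⊗ G) n (suc k)
        ∎

  functional-equation : G ⊗ (cst (+ 1) ⊖ P ⊗ U) ≐ X ⊗ U
  functional-equation = begin
    G ⊗ (cst (+ 1) ⊖ P ⊗ U)
      ≈⟨ solve 3 (λ g p u → g :* (con (+ 1) :- p :* u) := g :- p :* g :* u) ≐-refl G P U ⟩
    G ⊖ P ⊗ G ⊗ U
      ≈⟨ ⊖-cong G-recursion (≐-refl {P ⊗ G ⊗ U}) ⟩
    (X ⊕ P ⊗ G) ⊗ U ⊖ P ⊗ G ⊗ U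
      ≈⟨ solve 4 (λ x p g u → (x :+ p :* g) :* u :- p :* g :* u := x :* u) ≐-refl X P G U ⟩
    X ⊗ U
      ∎
    where open ≐-Reasoning

  first-form : G ⊗ r ⊗ (T ⊖ X ⊗ U) ≐ X ⊗ U
  first-form = begin
    G ⊗ r ⊗ (T ⊖ X ⊗ U)
      ≈⟨ solve 5 (λ g r t x u → g :* r :* (t :- x :* u) := g :* (r :* t :- r :* x :* u)) ≐-refl G r T X U ⟩
    G ⊗ (r ⊗ T ⊖ P ⊗ U)
      ≈⟨ ⊗-cong (≐-refl {G}) (⊖-cong r⊗T≐1 (≐-refl {P ⊗ U})) ⟩
    G ⊗ (cst (+ 1) ⊖ P ⊗ U)
      ≈⟨ functional-equation ⟩
    X ⊗ U
      ∎
    where open ≐-Reasoning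

  second-form : G ⊗ (cst (+ 2) ⊗ U ⊗ U ⊗ X ⊖ cst (+ 2) ⊗ U ⊕ cst (+ 2))
              ≐ (cst (+ 2) ⊖ U ⊖ S ⊗ U) ⊗ X ⊗ U
  second-form = begin
    G ⊗ (cst (+ 2) ⊗ U ⊗ U ⊗ X ⊖ cst (+ 2) ⊗ U ⊕ cst (+ 2))
      ≈⟨ ⊗-cong (≐-refl {G}) kernel-factorisation ⟩
    G ⊗ ((cst (+ 1) ⊖ P ⊗ U) ⊗ (cst (+ 2) ⊖ cst (+ 2) ⊗ T ⊗ U))
      ≈⟨ ⊗-assoc G (cst (+ 1) ⊖ P ⊗ U) (cst (+ 2) ⊖ cst (+ 2) ⊗ T ⊗ U) ⟨
    G ⊗ (cst (+ 1) ⊖ P ⊗ U) ⊗ (cst (+ 2) ⊖ cst (+ 2) ⊗ T ⊗ U)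
      ≈⟨ ⊗-cong functional-equation (⊖-cong (≐-refl {cst (+ 2)}) (⊗-cong 2T≐1+S (≐-refl {U}))) ⟩
    X ⊗ U ⊗ (cst (+ 2) ⊖ (cst (+ 1) ⊕ S) ⊗ U)
      ≈⟨ solve 3 (λ x u s → x :* u :* (con (+ 2) :- (con (+ 1) :+ s) :* u) := (con (+ 2) :- u :- s :* u) :* x :* u)
                 ≐-refl X U S ⟩
    (cst (+ 2) ⊖ U ⊖ S ⊗ U) ⊗ X ⊗ U
      ∎
    where open ≐-Reasoning

theorem2p2 :
    -- g n k = number of Stanley polyominoes with col = n, first = k,
    -- so G(u) = Σ_P x^col(P) u^first(P) has coefficients G n k = + g n k
    (g : ℕ → ℕ → ℕ) → (∀ n k → Fin (g n k) ↔ StanleyWith n k) →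
    -- S = sqrt(1 - 4x), r = (1 - S)/(2x), T = x s = (1 + S)/2
    (S r T : Ser) →
    OnlyX S → S 0 0 ≡ + 1 → S ⊗ S ≐ cst (+ 1) ⊖ cst (+ 4) ⊗ X →
    cst (+ 2) ⊗ X ⊗ r ≐ cst (+ 1) ⊖ S →
    cst (+ 2) ⊗ T ≐ cst (+ 1) ⊕ S →
    let G : Ser
        G = λ n k → + g n k
    in
    -- G = u / (r (s - u)), written as  G · r · (x s - x u) = x u
    (G ⊗ r ⊗ (T ⊖ X ⊗ U) ≐ X ⊗ U)
    -- G = (2 - u - sqrt(1-4x) u) x u / (2 u² x - 2 u + 2)
    × (G ⊗ (cst (+ 2) ⊗ U ⊗ U ⊗ X ⊖ cst (+ 2) ⊗ U ⊕ cst (+ 2))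
        ≐ (cst (+ 2) ⊖ U ⊖ S ⊗ U) ⊗ X ⊗ U)
    -- [u^k] G = x (r x)^(k-1)  for k ≥ 1
    × (∀ k → 1 ≤ k → ∀ n → G n k ≡ (X ⊗ ((r ⊗ X) ^ˢ (k ∸ 1))) n 0)
    -- [x^n u^k] G = (k-1)/(2n-k-1) · C(2n-k-1, n-k)  for n ≥ 2, 1 ≤ k ≤ n
    × (∀ n k → 2 ≤ n → 1 ≤ k → k ≤ n →
        g n k * (2 * n ∸ k ∸ 1) ≡ (k ∸ 1) * ((2 * n ∸ k ∸ 1) C (n ∸ k)))
theorem2p2 g count S r T onlyX-S _ S²≐1-4X 2Xr≐1-S 2T≐1+S =
  first-form , second-form , (λ { (suc k) _ n → u-coefficient k n }) , (λ n k _ → closed-form n k)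
  where open GeneratingFunction g count S r T onlyX-S S²≐1-4X 2Xr≐1-S 2T≐1+S
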